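{- Define the following subsets of $\mathbb{Z}^4$ (elements written $(a,b,c,d)$): $X_1=\{b\text{ odd},\ c\equiv2\ (4),\ d\equiv0\ (8)\}$; $X_1'=\{c\text{ odd},\ b\equiv2\ (4),\ a\equiv0\ (8)\}$; $X_1''=\{b+c\text{ odd},\ a+c\equiv0\ (4),\ a+b+c+d\equiv0\ (8)\}$; $X_2=\{b\text{ odd},\ c\equiv2\ (4),\ d\equiv4\ (8)\}$; $X_2'=\{c\text{ odd},\ b\equiv2\ (4),\ a\equiv4\ (8)\}$; $X_2''=\{b+c\text{ odd},\ a+c\equiv0\ (4),\ a+b+c+d\equiv4\ (8)\}$; $X_3=\{a\text{ odd},\ b,c\text{ even},\ d\equiv2\ (4)\}$; $X_3'=\{d\text{ odd},\ b,c\text{ even},\ a\equiv2\ (4)\}$; $X_3''=\{a,b,c,d\text{ all odd},\ a+b+c+d\equiv2\ (4)\}$. Then $L_1^{\equiv4(32)}=X_1\sqcup X_1'\sqcup X_1''$ and $L_1^{\equiv20(32)}=X_2\sqcup X_2'\sqcup X_2''\sqcup X_3\sqcup X_3'\sqcup X_3''$ (disjoint unions).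
   Context: Identify binary cubic forms $au^3+bu^2v+cuv^2+dv^3$ with $(a,b,c,d)$, and let $P(x)=b^2c^2+18abcd-4ac^3-4b^3d-27a^2d^2$. For integers $l,N$, $L_1^{\equiv l(N)}=\{x\in\mathbb{Z}^4\mid P(x)\equiv l\bmod N\}$. -}

module Defs where

open import Data.Integer using (ℤ; +_; _+_; _-_; _*_)
open import Data.Integer.Divisibility using (_∣_)
open import Data.Nat using (ℕ)
open import Data.Product using (_×_; _,_)
open import Data.Sum using (_⊎_)
open import Data.Empty using (⊥)
open import Relation.Nullary using (¬_)
open import Function.Bundles using (_⇔_)

-- binary cubic forms a u^3 + b u^2 v + c u v^2 + d v^3 identified with (a,b,c,d)
ℤ⁴ : Set
ℤ⁴ = ℤ × ℤ × ℤ × ℤ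

_≡_[mod_] : ℤ → ℤ → ℕ → Set
x ≡ y [mod N ] = (+ N) ∣ (x - y)

infix 4 _≡_[mod_]

P : ℤ⁴ → ℤ
P (a , b , c , d) =
  b * b * c * c + + 18 * a * b * c * d - + 4 * a * c * c * c
  - + 4 * b * b * b * d - + 27 * a * a * d * d

L₁ : ℤ → ℕ → ℤ⁴ → Set
L₁ l N x = P x ≡ l [mod N ]

Odd Even : ℤ → Set
Odd n = n ≡ + 1 [mod 2 ]
Even n = n ≡ + 0 [mod 2 ]

X₁ X₁′ X₁″ X₂ X₂′ X₂″ X₃ X₃′ X₃″ : ℤ⁴ → Set
X₁ (a , b , c , d) = Odd b × c ≡ + 2 [mod 4 ] × d ≡ + 0 [mod 8 ]
X₁′ (a , b , c , d) = Odd c × b ≡ + 2 [mod 4 ] × a ≡ + 0 [mod 8 ]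
X₁″ (a , b , c , d) = Odd (b + c) × a + c ≡ + 0 [mod 4 ] × a + b + c + d ≡ + 0 [mod 8 ]
X₂ (a , b , c , d) = Odd b × c ≡ + 2 [mod 4 ] × d ≡ + 4 [mod 8 ]
X₂′ (a , b , c , d) = Odd c × b ≡ + 2 [mod 4 ] × a ≡ + 4 [mod 8 ]
X₂″ (a , b , c , d) = Odd (b + c) × a + c ≡ + 0 [mod 4 ] × a + b + c + d ≡ + 4 [mod 8 ]
X₃ (a , b , c , d) = Odd a × Even b × Even c × d ≡ + 2 [mod 4 ]
X₃′ (a , b , c , d) = Odd d × Even b × Even c × a ≡ + 2 [mod 4 ]
X₃″ (a , b , c , d) = Odd a × Odd b × Odd c × Odd d × a + b + c + d ≡ + 2 [mod 4 ]

open import Data.List using (List; []; _∷_)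

open import Data.Unit.Polymorphic using (⊤)

AllDisjoint : (ℤ⁴ → Set) → List (ℤ⁴ → Set) → Set₁
AllDisjoint S [] = ⊤
AllDisjoint S (T ∷ Ts) = (∀ x → S x → T x → ⊥) × AllDisjoint S Ts

PairwiseDisjoint : List (ℤ⁴ → Set) → Set₁
PairwiseDisjoint [] = ⊤
PairwiseDisjoint (S ∷ Ss) = AllDisjoint S Ss × PairwiseDisjoint Ss

⋃ : List (ℤ⁴ → Set) → ℤ⁴ → Set
⋃ [] x = ⊥
⋃ (S ∷ Ss) x = S x ⊎ ⋃ Ss x

{-# OPTIONS --safe #-}
-- Write P = (bc + ad)² − 4R with R = ac³ + b³d + 7a²d² − 4abcd. Then P ≡ (bc + ad)² (mod 4),
-- so P is even exactly when bc + ad is; and if u = bc + ad is even and u ≡ v (mod 8), then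
-- u² − v² = (u − v)(u + v) is divisible by 8 · 4, while 4R changes by a multiple of 4 · 8.
-- Hence for even l the condition P ≡ l (mod 32) depends only on (a, b, c, d) modulo 8, and so do
-- the defining conditions of all the sets X. Both set identities and the disjointness are
-- therefore properties of the 8⁴ residue classes, which are checked by evaluation.
module Submission where

open import Defs
open import Data.Integer using (ℤ; +_; _+_; _-_; _*_; -_; ∣_∣)
open import Data.Integer.DivMod using (_%ℕ_; _/ℕ_; a≡a%ℕn+[a/ℕn]*n; n%ℕd<d)
open import Data.Integer.Divisibility.Signed
  using ( divides; ∣ᵤ⇒∣; ∣⇒∣ᵤ; ∣-refl; ∣-trans; ∣m∣n⇒∣m+n; ∣m∣n⇒∣m-n; ∣m⇒∣-m
        ; ∣m⇒∣m*n; ∣n⇒∣m*n; *-monoʳ-∣)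
  renaming (_∣_ to _∣ₛ_)
open import Data.Integer.Properties using (abs-*; pos-*; +-identityʳ; +-inverseʳ)
open import Data.Integer.Tactic.RingSolver using (solve-∀)
open import Data.Nat as ℕ using (ℕ)
open import Data.Nat.Divisibility using (_∣?_) renaming (_∣_ to _ℕ∣_)
open import Data.Nat.Primality using (euclidsLemma; prime[2])
open import Data.Fin using (Fin; toℕ; fromℕ<)
open import Data.Fin.Properties using (all?; toℕ-fromℕ<)
open import Data.List using (List; []; _∷_; map)
open import Data.List.Relation.Unary.All as All using (All; []; _∷_)
open import Data.List.Relation.Unary.AllPairs using (AllPairs; []; _∷_; allPairs?)
import Data.List.Relation.Unary.AllPairs as AllPairs
open import Data.Product using (_×_; _,_)
open import Data.Sum using (inj₁; inj₂; reduce)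
open import Data.Unit.Polymorphic using (tt)
open import Function using (_∘_)
open import Function.Bundles using (_⇔_; mk⇔; Equivalence)
open import Relation.Binary.Definitions using (_Respects_)
open import Relation.Binary.PropositionalEquality using (_≡_; refl; sym; trans; cong; subst; subst₂)
open import Relation.Nullary using (Dec; no; ¬_)
open import Relation.Nullary.Decidable using (_×-dec_; _⊎-dec_; _→-dec_; ¬?; True; toWitness)
import Relation.Nullary.Decidable as Dec
open import Relation.Unary using (Decidable)

private variable
  m n : ℕ
  e x y z u v : ℤ

-- Congruences of integers

-- x ≡ y [mod n ] unfolds to n ∣ ∣ x - y ∣ in ℕ, from which Agda cannot infer x, y and n;
-- the congruence calculus below works with this record copy, which keeps them as indices.
record _≋_[mod_] (x y : ℤ) (n : ℕ) : Set where
  constructor mod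
  field
    divides-diff : + n ∣ₛ x - y

infix 4 _≋_[mod_]

open _≋_[mod_]

≋⇒≡ : x ≋ y [mod n ] → x ≡ y [mod n ]
≋⇒≡ = ∣⇒∣ᵤ ∘ divides-diff

≡⇒≋ : x ≡ y [mod n ] → x ≋ y [mod n ]
≡⇒≋ x≡y = mod (∣ᵤ⇒∣ x≡y)

mod-by : ∀ e → x - y ≡ e → + n ∣ₛ e → x ≋ y [mod n ]
mod-by _ eq n∣e = mod (subst (_ ∣ₛ_) (sym eq) n∣e)

mod-refl : x ≋ x [mod n ]
mod-refl {x = x} = mod-by (+ 0) (+-inverseʳ x) (divides (+ 0) refl)

mod-sym : x ≋ y [mod n ] → y ≋ x [mod n ]
mod-sym {x = x} {y = y} (mod n∣x-y) = mod-by _ (lemma x y) (∣m⇒∣-m n∣x-y)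
  where
  lemma : ∀ x y → y - x ≡ - (x - y)
  lemma = solve-∀

mod-trans : x ≋ y [mod n ] → y ≋ z [mod n ] → x ≋ z [mod n ]
mod-trans {x = x} {y = y} {z = z} (mod n∣x-y) (mod n∣y-z) =
  mod-by _ (lemma x y z) (∣m∣n⇒∣m+n n∣x-y n∣y-z)
  where
  lemma : ∀ x y z → x - z ≡ (x - y) + (y - z)
  lemma = solve-∀

infixl 6 _+ₘ_ _-ₘ_
infixl 7 _*ₘ_

_+ₘ_ : x ≋ y [mod n ] → u ≋ v [mod n ] → x + u ≋ y + v [mod n ]
_+ₘ_ {x = x} {y = y} {u = u} {v = v} (mod n∣x-y) (mod n∣u-v) =
  mod-by _ (lemma x y u v) (∣m∣n⇒∣m+n n∣x-y n∣u-v)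
  where
  lemma : ∀ x y u v → (x + u) - (y + v) ≡ (x - y) + (u - v)
  lemma = solve-∀

_-ₘ_ : x ≋ y [mod n ] → u ≋ v [mod n ] → x - u ≋ y - v [mod n ]
_-ₘ_ {x = x} {y = y} {u = u} {v = v} (mod n∣x-y) (mod n∣u-v) =
  mod-by _ (lemma x y u v) (∣m∣n⇒∣m-n n∣x-y n∣u-v)
  where
  lemma : ∀ x y u v → (x - u) - (y - v) ≡ (x - y) - (u - v)
  lemma = solve-∀

_*ₘ_ : x ≋ y [mod n ] → u ≋ v [mod n ] → x * u ≋ y * v [mod n ]
_*ₘ_ {x = x} {y = y} {u = u} {v = v} (mod n∣x-y) (mod n∣u-v) =
  mod-by _ (lemma x y u v) (∣m∣n⇒∣m+n (∣n⇒∣m*n u n∣x-y) (∣n⇒∣m*n y n∣u-v))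
  where
  lemma : ∀ x y u v → x * u - y * v ≡ u * (x - y) + y * (u - v)
  lemma = solve-∀

mod-weaken : + m ∣ₛ + n → x ≋ y [mod n ] → x ≋ y [mod m ]
mod-weaken m∣n (mod n∣x-y) = mod (∣-trans m∣n n∣x-y)

mod-scale : ∀ k → x ≋ y [mod n ] → + k * x ≋ + k * y [mod k ℕ.* n ]
mod-scale {x = x} {y = y} {n = n} k (mod n∣x-y) =
  mod-by _ (lemma (+ k) x y) (subst (_∣ₛ (+ k * (x - y))) (sym (pos-* k n)) (*-monoʳ-∣ (+ k) n∣x-y))
  where
  lemma : ∀ k x y → k * x - k * y ≡ k * (x - y)
  lemma = solve-∀

mod-transport : + n ∣ₛ + m → x ≋ y [mod m ] → x ≡ e [mod n ] → y ≡ e [mod n ]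
mod-transport n∣m x≡y x≡e = ≋⇒≡ (mod-trans (mod-weaken n∣m (mod-sym x≡y)) (≡⇒≋ x≡e))

mod0⇒∣ : x ≋ + 0 [mod n ] → + n ∣ₛ x
mod0⇒∣ {x = x} (mod n∣x-0) = subst (_ ∣ₛ_) (+-identityʳ x) n∣x-0

∣⇒mod0 : + n ∣ₛ x → x ≋ + 0 [mod n ]
∣⇒mod0 {x = x} = mod-by x (+-identityʳ x)

infix 4 _≡?_[mod_]

_≡?_[mod_] : ∀ x y n → Dec (x ≡ y [mod n ])
x ≡? y [mod n ] = n ∣? ∣ x - y ∣

2∣4 : + 2 ∣ₛ + 4
2∣4 = divides (+ 2) refl

2∣8 : + 2 ∣ₛ + 8
2∣8 = divides (+ 4) refl

4∣8 : + 4 ∣ₛ + 8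
4∣8 = divides (+ 2) refl

2∣32 : + 2 ∣ₛ + 32
2∣32 = divides (+ 16) refl

8∣8 : + 8 ∣ₛ + 8
8∣8 = divides (+ 1) refl

even-square⇒even : x * x ≋ + 0 [mod 2 ] → x ≋ + 0 [mod 2 ]
even-square⇒even {x = x} x²-even =
  ∣⇒mod0 (∣ᵤ⇒∣ {+ 2} {x} (reduce (euclidsLemma ∣ x ∣ ∣ x ∣ prime[2] 2∣x²)))
  where
  2∣x² : 2 ℕ∣ ∣ x ∣ ℕ.* ∣ x ∣
  2∣x² = subst (2 ℕ∣_) (abs-* x x) (∣⇒∣ᵤ {+ 2} {x * x} (mod0⇒∣ x²-even))

*-pres-∣ : ∀ {a b c d} → a ∣ₛ b → c ∣ₛ d → a * c ∣ₛ b * d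
*-pres-∣ {a} {c = c} (divides p refl) (divides q refl) = divides (p * q) (lemma p a q c)
  where
  lemma : ∀ p a q c → p * a * (q * c) ≡ p * q * (a * c)
  lemma = solve-∀

-- u² - v² = (u - v)(u + v), where 8 ∣ u - v and 4 ∣ u + v = 2u - (u - v).
square-mod32 : u ≋ v [mod 8 ] → u ≋ + 0 [mod 2 ] → u * u ≋ v * v [mod 32 ]
square-mod32 {u = u} {v = v} (mod 8∣u-v) u-even = mod-by _ (lemma u v)
  (*-pres-∣ 8∣u-v (∣m∣n⇒∣m-n (*-monoʳ-∣ (+ 2) (mod0⇒∣ u-even)) (∣-trans 4∣8 8∣u-v)))
  where
  lemma : ∀ u v → u * u - v * v ≡ (u - v) * (+ 2 * u - (u - v))
  lemma = solve-∀

-- Predicates on ℤ⁴ that depend only on residues modulo 8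

data _≈_[mod_] : ℤ⁴ → ℤ⁴ → ℕ → Set where
  mod⁴ : ∀ {a b c d a′ b′ c′ d′} →
         a ≋ a′ [mod n ] → b ≋ b′ [mod n ] → c ≋ c′ [mod n ] → d ≋ d′ [mod n ] →
         (a , b , c , d) ≈ (a′ , b′ , c′ , d′) [mod n ]

infix 4 _≈_[mod_]

≈-sym : ∀ {x y} → x ≈ y [mod n ] → y ≈ x [mod n ]
≈-sym (mod⁴ a b c d) = mod⁴ (mod-sym a) (mod-sym b) (mod-sym c) (mod-sym d)

residue : ℤ → Fin 8
residue z = fromℕ< (n%ℕd<d z 8)

residue-≋ : ∀ z → + toℕ (residue z) ≋ z [mod 8 ]
residue-≋ z rewrite toℕ-fromℕ< (n%ℕd<d z 8) =
  mod-by _ (cong (_-_ (+ (z %ℕ 8))) (a≡a%ℕn+[a/ℕn]*n z 8))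
           (divides (- (z /ℕ 8)) (lemma (+ (z %ℕ 8)) (z /ℕ 8)))
  where
  lemma : ∀ r q → r - (r + q * + 8) ≡ - q * + 8
  lemma = solve-∀

OnResidues : ∀ {ℓ} → (ℤ⁴ → Set ℓ) → Set ℓ
OnResidues Q = ∀ (i j k l : Fin 8) → Q (+ toℕ i , + toℕ j , + toℕ k , + toℕ l)

onResidues? : ∀ {ℓ} {Q : ℤ⁴ → Set ℓ} → Decidable Q → Dec (OnResidues Q)
onResidues? Q? = all? λ i → all? λ j → all? λ k → all? λ l → Q? _

fromResidues : ∀ {ℓ} {Q : ℤ⁴ → Set ℓ} → Q Respects _≈_[mod 8 ] → OnResidues Q → ∀ x → Q x
fromResidues resp onResidues (a , b , c , d) =
  resp (mod⁴ (residue-≋ a) (residue-≋ b) (residue-≋ c) (residue-≋ d))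
       (onResidues (residue a) (residue b) (residue c) (residue d))

record Mod8Predicate : Set₁ where
  field
    holds    : ℤ⁴ → Set
    decide   : Decidable holds
    respects : holds Respects _≈_[mod 8 ]

open Mod8Predicate

⋃-decide : ∀ ps → Decidable (⋃ (map holds ps))
⋃-decide [] x = no λ ()
⋃-decide (p ∷ ps) x = decide p x ⊎-dec ⋃-decide ps x

⋃-respects : ∀ ps → ⋃ (map holds ps) Respects _≈_[mod 8 ]
⋃-respects [] x≈y ()
⋃-respects (p ∷ ps) x≈y (inj₁ px) = inj₁ (respects p x≈y px)
⋃-respects (p ∷ ps) x≈y (inj₂ qx) = inj₂ (⋃-respects ps x≈y qx)

⋃-mod8 : List Mod8Predicate → Mod8Predicate
⋃-mod8 ps = record { holds = ⋃ (map holds ps) ; decide = ⋃-decide ps ; respects = ⋃-respects ps }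

_⇔?_ : ∀ {A B : Set} → Dec A → Dec B → Dec (A ⇔ B)
A? ⇔? B? = Dec.map (mk⇔ (λ (f , g) → mk⇔ f g) (λ A⇔B → Equivalence.to A⇔B , Equivalence.from A⇔B))
                   ((A? →-dec B?) ×-dec (B? →-dec A?))

Agree : Mod8Predicate → Mod8Predicate → ℤ⁴ → Set
Agree p q x = holds p x ⇔ holds q x

agree? : ∀ p q → Decidable (Agree p q)
agree? p q x = decide p x ⇔? decide q x

agree-respects : ∀ p q → Agree p q Respects _≈_[mod 8 ]
agree-respects p q x≈y p⇔q = mk⇔
  (respects q x≈y ∘ Equivalence.to p⇔q ∘ respects p (≈-sym x≈y))
  (respects p x≈y ∘ Equivalence.from p⇔q ∘ respects q (≈-sym x≈y))

agree-byResidues : ∀ p q → {True (onResidues? (agree? p q))} → ∀ x → Agree p q x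
agree-byResidues p q {onResidues} = fromResidues (agree-respects p q) (toWitness onResidues)

DisjointAt : ℤ⁴ → Mod8Predicate → Mod8Predicate → Set
DisjointAt x p q = ¬ (holds p x × holds q x)

PairwiseDisjointAt : List Mod8Predicate → ℤ⁴ → Set₁
PairwiseDisjointAt ps x = AllPairs (DisjointAt x) ps

pairwiseDisjointAt? : ∀ ps → Decidable (PairwiseDisjointAt ps)
pairwiseDisjointAt? ps x = allPairs? (λ p q → ¬? (decide p x ×-dec decide q x)) ps

pairwiseDisjointAt-respects : ∀ ps → PairwiseDisjointAt ps Respects _≈_[mod 8 ]
pairwiseDisjointAt-respects ps x≈y = AllPairs.map λ {p} {q} ¬both (py , qy) →
  ¬both (respects p (≈-sym x≈y) py , respects q (≈-sym x≈y) qy)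

pairwiseDisjoint : ∀ ps → (∀ x → PairwiseDisjointAt ps x) → PairwiseDisjoint (map holds ps)
pairwiseDisjoint [] _ = tt
pairwiseDisjoint (p ∷ ps) disjointAt =
  allDisjoint ps (λ x → AllPairs.head (disjointAt x)) , pairwiseDisjoint ps (λ x → AllPairs.tail (disjointAt x))
  where
  allDisjoint : ∀ qs → (∀ x → All (DisjointAt x p) qs) → AllDisjoint (holds p) (map holds qs)
  allDisjoint [] _ = tt
  allDisjoint (q ∷ qs) disjointAt =
    (λ x px qx → All.head (disjointAt x) (px , qx)) , allDisjoint qs (λ x → All.tail (disjointAt x))

pairwiseDisjoint-byResidues : ∀ ps → {True (onResidues? (pairwiseDisjointAt? ps))} →
                              PairwiseDisjoint (map holds ps)
pairwiseDisjoint-byResidues ps {onResidues} =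
  pairwiseDisjoint ps (fromResidues (pairwiseDisjointAt-respects ps) (toWitness onResidues))

-- The discriminant modulo 32

bc+ad : ℤ⁴ → ℤ
bc+ad (a , b , c , d) = b * c + a * d

R : ℤ⁴ → ℤ
R (a , b , c , d) = a * c * c * c + b * b * b * d + + 7 * a * a * d * d - + 4 * a * b * c * d

P≡[bc+ad]²-4R : ∀ x → P x ≡ bc+ad x * bc+ad x - + 4 * R x
P≡[bc+ad]²-4R (a , b , c , d) = lemma a b c d
  where
  lemma : ∀ a b c d →
    b * b * c * c + + 18 * a * b * c * d - + 4 * a * c * c * c - + 4 * b * b * b * d - + 27 * a * a * d * d
    ≡ (b * c + a * d) * (b * c + a * d)
      - + 4 * (a * c * c * c + b * b * b * d + + 7 * a * a * d * d - + 4 * a * b * c * d)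
  lemma = solve-∀

bc+ad-cong : ∀ {x y} → x ≈ y [mod n ] → bc+ad x ≋ bc+ad y [mod n ]
bc+ad-cong (mod⁴ a b c d) = b *ₘ c +ₘ a *ₘ d

R-cong : ∀ {x y} → x ≈ y [mod n ] → R x ≋ R y [mod n ]
R-cong (mod⁴ a b c d) =
  a *ₘ c *ₘ c *ₘ c +ₘ b *ₘ b *ₘ b *ₘ d
  +ₘ mod-refl {x = + 7} *ₘ a *ₘ a *ₘ d *ₘ d -ₘ mod-refl {x = + 4} *ₘ a *ₘ b *ₘ c *ₘ d

P-mod32 : ∀ {x y} → x ≈ y [mod 8 ] → bc+ad x ≋ + 0 [mod 2 ] → P x ≋ P y [mod 32 ]
P-mod32 {x} {y} x≈y even =
  subst₂ _≋_[mod 32 ] (sym (P≡[bc+ad]²-4R x)) (sym (P≡[bc+ad]²-4R y))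
    (square-mod32 (bc+ad-cong x≈y) even -ₘ mod-scale 4 (R-cong x≈y))

P≋[bc+ad]² : ∀ x → P x ≋ bc+ad x * bc+ad x [mod 4 ]
P≋[bc+ad]² x = mod-by (- (+ 4 * R x))
  (trans (cong (_- bc+ad x * bc+ad x) (P≡[bc+ad]²-4R x)) (lemma (bc+ad x * bc+ad x) (R x)))
  (∣m⇒∣-m (∣m⇒∣m*n (R x) ∣-refl))
  where
  lemma : ∀ s r → (s - + 4 * r) - s ≡ - (+ 4 * r)
  lemma = solve-∀

even-P⇒even-bc+ad : ∀ {x} → P x ≋ + 0 [mod 2 ] → bc+ad x ≋ + 0 [mod 2 ]
even-P⇒even-bc+ad {x} P-even =
  even-square⇒even (mod-trans (mod-sym (mod-weaken 2∣4 (P≋[bc+ad]² x))) P-even)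

L₁-respects : ∀ {l} → l ≋ + 0 [mod 2 ] → (L₁ l 32) Respects _≈_[mod 8 ]
L₁-respects l-even {x} x≈y Lx = ≋⇒≡ (mod-trans (mod-sym (P-mod32 x≈y bc+ad-even)) (≡⇒≋ Lx))
  where
  bc+ad-even : bc+ad x ≋ + 0 [mod 2 ]
  bc+ad-even = even-P⇒even-bc+ad {x} (mod-trans (mod-weaken 2∣32 (≡⇒≋ Lx)) l-even)

L₁-mod8 : ∀ l → l ≋ + 0 [mod 2 ] → Mod8Predicate
L₁-mod8 l l-even = record
  { holds = L₁ l 32
  ; decide = λ x → P x ≡? l [mod 32 ]
  ; respects = L₁-respects l-even
  }

X₁-mod8 : Mod8Predicate
X₁-mod8 = record
  { holds = X₁
  ; decide = λ (a , b , c , d) → b ≡? + 1 [mod 2 ] ×-dec c ≡? + 2 [mod 4 ] ×-dec d ≡? + 0 [mod 8 ]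
  ; respects = λ { (mod⁴ a b c d) (b≡1 , c≡2 , d≡0) →
      mod-transport 2∣8 b b≡1 , mod-transport 4∣8 c c≡2 , mod-transport {e = + 0} 8∣8 d d≡0 }
  }

X₁′-mod8 : Mod8Predicate
X₁′-mod8 = record
  { holds = X₁′
  ; decide = λ (a , b , c , d) → c ≡? + 1 [mod 2 ] ×-dec b ≡? + 2 [mod 4 ] ×-dec a ≡? + 0 [mod 8 ]
  ; respects = λ { (mod⁴ a b c d) (c≡1 , b≡2 , a≡0) →
      mod-transport 2∣8 c c≡1 , mod-transport 4∣8 b b≡2 , mod-transport {e = + 0} 8∣8 a a≡0 }
  }

X₁″-mod8 : Mod8Predicate
X₁″-mod8 = record
  { holds = X₁″
  ; decide = λ (a , b , c , d) →
      b + c ≡? + 1 [mod 2 ] ×-dec a + c ≡? + 0 [mod 4 ] ×-dec a + b + c + d ≡? + 0 [mod 8 ]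
  ; respects = λ { (mod⁴ a b c d) (b+c≡1 , a+c≡0 , a+b+c+d≡0) →
      mod-transport 2∣8 (b +ₘ c) b+c≡1 , mod-transport {e = + 0} 4∣8 (a +ₘ c) a+c≡0 ,
      mod-transport {e = + 0} 8∣8 (a +ₘ b +ₘ c +ₘ d) a+b+c+d≡0 }
  }

X₂-mod8 : Mod8Predicate
X₂-mod8 = record
  { holds = X₂
  ; decide = λ (a , b , c , d) → b ≡? + 1 [mod 2 ] ×-dec c ≡? + 2 [mod 4 ] ×-dec d ≡? + 4 [mod 8 ]
  ; respects = λ { (mod⁴ a b c d) (b≡1 , c≡2 , d≡4) →
      mod-transport 2∣8 b b≡1 , mod-transport 4∣8 c c≡2 , mod-transport 8∣8 d d≡4 }
  }

X₂′-mod8 : Mod8Predicate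
X₂′-mod8 = record
  { holds = X₂′
  ; decide = λ (a , b , c , d) → c ≡? + 1 [mod 2 ] ×-dec b ≡? + 2 [mod 4 ] ×-dec a ≡? + 4 [mod 8 ]
  ; respects = λ { (mod⁴ a b c d) (c≡1 , b≡2 , a≡4) →
      mod-transport 2∣8 c c≡1 , mod-transport 4∣8 b b≡2 , mod-transport 8∣8 a a≡4 }
  }

X₂″-mod8 : Mod8Predicate
X₂″-mod8 = record
  { holds = X₂″
  ; decide = λ (a , b , c , d) →
      b + c ≡? + 1 [mod 2 ] ×-dec a + c ≡? + 0 [mod 4 ] ×-dec a + b + c + d ≡? + 4 [mod 8 ]
  ; respects = λ { (mod⁴ a b c d) (b+c≡1 , a+c≡0 , a+b+c+d≡4) →
      mod-transport 2∣8 (b +ₘ c) b+c≡1 , mod-transport {e = + 0} 4∣8 (a +ₘ c) a+c≡0 ,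
      mod-transport 8∣8 (a +ₘ b +ₘ c +ₘ d) a+b+c+d≡4 }
  }

X₃-mod8 : Mod8Predicate
X₃-mod8 = record
  { holds = X₃
  ; decide = λ (a , b , c , d) →
      a ≡? + 1 [mod 2 ] ×-dec b ≡? + 0 [mod 2 ] ×-dec c ≡? + 0 [mod 2 ] ×-dec d ≡? + 2 [mod 4 ]
  ; respects = λ { (mod⁴ a b c d) (a≡1 , b≡0 , c≡0 , d≡2) →
      mod-transport 2∣8 a a≡1 , mod-transport {e = + 0} 2∣8 b b≡0 ,
      mod-transport {e = + 0} 2∣8 c c≡0 , mod-transport 4∣8 d d≡2 }
  }

X₃′-mod8 : Mod8Predicate
X₃′-mod8 = record
  { holds = X₃′
  ; decide = λ (a , b , c , d) →
      d ≡? + 1 [mod 2 ] ×-dec b ≡? + 0 [mod 2 ] ×-dec c ≡? + 0 [mod 2 ] ×-dec a ≡? + 2 [mod 4 ]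
  ; respects = λ { (mod⁴ a b c d) (d≡1 , b≡0 , c≡0 , a≡2) →
      mod-transport 2∣8 d d≡1 , mod-transport {e = + 0} 2∣8 b b≡0 ,
      mod-transport {e = + 0} 2∣8 c c≡0 , mod-transport 4∣8 a a≡2 }
  }

X₃″-mod8 : Mod8Predicate
X₃″-mod8 = record
  { holds = X₃″
  ; decide = λ (a , b , c , d) →
      a ≡? + 1 [mod 2 ] ×-dec b ≡? + 1 [mod 2 ] ×-dec c ≡? + 1 [mod 2 ] ×-dec d ≡? + 1 [mod 2 ]
      ×-dec a + b + c + d ≡? + 2 [mod 4 ]
  ; respects = λ { (mod⁴ a b c d) (a≡1 , b≡1 , c≡1 , d≡1 , a+b+c+d≡2) →
      mod-transport 2∣8 a a≡1 , mod-transport 2∣8 b b≡1 ,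
      mod-transport 2∣8 c c≡1 , mod-transport 2∣8 d d≡1 ,
      mod-transport 4∣8 (a +ₘ b +ₘ c +ₘ d) a+b+c+d≡2 }
  }

lemma2p6 :
    ((∀ x → L₁ (+ 4) 32 x ⇔ ⋃ (X₁ ∷ X₁′ ∷ X₁″ ∷ []) x)
      × PairwiseDisjoint (X₁ ∷ X₁′ ∷ X₁″ ∷ []))
    × ((∀ x → L₁ (+ 20) 32 x ⇔ ⋃ (X₂ ∷ X₂′ ∷ X₂″ ∷ X₃ ∷ X₃′ ∷ X₃″ ∷ []) x)
      × PairwiseDisjoint (X₂ ∷ X₂′ ∷ X₂″ ∷ X₃ ∷ X₃′ ∷ X₃″ ∷ []))
lemma2p6 =
  (agree-byResidues (L₁-mod8 (+ 4) 4-even) (⋃-mod8 X₁s) , pairwiseDisjoint-byResidues X₁s) ,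
  (agree-byResidues (L₁-mod8 (+ 20) 20-even) (⋃-mod8 X₂₃s) , pairwiseDisjoint-byResidues X₂₃s)
  where
  4-even : + 4 ≋ + 0 [mod 2 ]
  4-even = mod (divides (+ 2) refl)
  20-even : + 20 ≋ + 0 [mod 2 ]
  20-even = mod (divides (+ 10) refl)
  X₁s X₂₃s : List Mod8Predicate
  X₁s = X₁-mod8 ∷ X₁′-mod8 ∷ X₁″-mod8 ∷ []
  X₂₃s = X₂-mod8 ∷ X₂′-mod8 ∷ X₂″-mod8 ∷ X₃-mod8 ∷ X₃′-mod8 ∷ X₃″-mod8 ∷ []
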